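{- Let $n\ge 3$ and let $x,y$ be pyramidal tours in $K_n$ with encodings $x^{c},y^{c}\in\{0,1\}^{\{3,\dots,n-1\}}$. The vertices $x^{v}$ and $y^{v}$ of $\mathrm{PYR}(n)$ are not adjacent if and only if at least one of the following two conditions holds: (1) there exists $k$ with $3<k<n-2$ such that $x^{c}_{k}=y^{c}_{k}\neq x^{c}_{k+1}=y^{c}_{k+1}$, and there exist indices $i<k$ and $j>k+1$ (with $3\le i$, $j\le n-1$) such that $x^{c}_{i}\ne y^{c}_{i}$ and $x^{c}_{j}\ne y^{c}_{j}$; (2) there exists $k$ with $3\le k<n-2$ such that $x^{c}_{k}=y^{c}_{k+1}\neq x^{c}_{k+1}=y^{c}_{k}$, and there exists $j>k+1$ (with $j\le n-1$) such that $x^{c}_{j}=y^{c}_{j}$.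
   Context: Let $K_n$ be the complete undirected graph on vertex set $\{1,\dots,n\}$ with edge set $E$. A Hamiltonian tour $\langle 1,i_1,\dots,i_r,n,j_1,\dots,j_{n-r-2}\rangle$ is called pyramidal if $i_1<\dots<i_r$ and $j_1>\dots>j_{n-r-2}$ (tours are undirected). Every pyramidal tour contains the edge $\{1,2\}$; orient each pyramidal tour so that it starts $1\to 2$, and call the vertices visited on the way from $1$ to $n$ the vertices in increasing order. The encoding of a pyramidal tour $x$ is the 0/1 vector $x^{c}=(x^c_3,\dots,x^c_{n-1})$ with $x^{c}_{i}=1$ if vertex $i$ is visited in increasing order and $x^c_i=0$ otherwise (so there are $2^{n-3}$ pyramidal tours). The characteristic vector $x^{v}\in\mathbb{R}^{E}$ has $x^{v}_e=1$ iff $e$ is an edge of $x$. $\mathrm{PYR}(n)=\mathrm{conv}\{x^{v} : x$ pyramidal tour in $K_n\}$. Two vertices of a polytope are adjacent if the segment joining them is a one-dimensional face of the polytope.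
   Formalization: Adjacency of $x^{v}$ and $y^{v}$ is expressed through linear functionals on the edge space with rational coefficients rather than real ones. -}

module Defs where

open import Data.Bool using (Bool; true; false; if_then_else_; not; _∨_; _∧_)
open import Data.Nat using (ℕ; zero; suc; _+_; _∸_; _≤_; _<_; _≡ᵇ_; _<ᵇ_)
open import Data.List using (List; []; _∷_; _++_; map; reverse; filter; zip; concatMap; foldr)
open import Data.List.Base using (upTo)
open import Data.Vec using (Vec; lookup)
open import Data.Fin using (Fin; fromℕ<)
open import Data.Product using (_×_; _,_; Σ; ∃; ∃-syntax)
open import Data.Sum using (_⊎_)
open import Data.Rational using (ℚ; 0ℚ; 1ℚ) renaming (_+_ to _+ℚ_; _*_ to _*ℚ_; _≤_ to _≤ℚ_; _<_ to _<ℚ_)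
open import Relation.Binary.PropositionalEquality using (_≡_; _≢_)
open import Relation.Nullary using (¬_; yes; no)
open import Data.Nat.Properties using (_<?_; _≤?_)

-- An encoding of a pyramidal tour in K_n: a vector of n ∸ 3 booleans;
-- entry number t (0-based) is x^c_{t+3}.
Enc : ℕ → Set
Enc n = Vec Bool (n ∸ 3)

-- x^c_i for a vertex label i ∈ {3,…,n-1}; false outside this range (never used there).
xc : ∀ n → Enc n → ℕ → Bool
xc n x i with 3 ≤? i | (i ∸ 3) <? (n ∸ 3)
... | yes _ | yes p = lookup x (fromℕ< p)
... | _     | _     = false

range : ℕ → ℕ → List ℕ
range a b = map (λ t → a + t) (upTo (b ∸ a))

keep : (ℕ → Bool) → List ℕ → List ℕ
keep p [] = []
keep p (a ∷ l) = if p a then a ∷ keep p l else keep p l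

tourSeq : ∀ n → Enc n → List ℕ
tourSeq n x =
  1 ∷ 2 ∷ (keep (xc n x) (range 3 n) ++
           (n ∷ (reverse (keep (λ i → not (xc n x i)) (range 3 n)) ++ (1 ∷ []))))

steps : List ℕ → List (ℕ × ℕ)
steps [] = []
steps (a ∷ []) = []
steps (a ∷ b ∷ l) = (a , b) ∷ steps (b ∷ l)

inTour : ∀ n → Enc n → ℕ → ℕ → Bool
inTour n x a b =
  foldr (λ { (p , q) r → ((p ≡ᵇ a) ∧ (q ≡ᵇ b)) ∨ ((p ≡ᵇ b) ∧ (q ≡ᵇ a)) ∨ r }) false
        (steps (tourSeq n x))

edges : ℕ → List (ℕ × ℕ)
edges n = concatMap (λ a → map (λ b → (a , b)) (range (suc a) (suc n))) (range 1 (suc n))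

charVec : ∀ n → Enc n → List ℚ
charVec n x = map (λ { (a , b) → if inTour n x a b then 1ℚ else 0ℚ }) (edges n)

value : ∀ n → (ℕ → ℕ → ℚ) → Enc n → ℚ
value n c x = foldr _+ℚ_ 0ℚ
  (map (λ { (a , b) → c a b *ℚ (if inTour n x a b then 1ℚ else 0ℚ) }) (edges n))

-- Adjacency of vertices x^v, y^v of PYR(n): the segment [x^v, y^v] is a
-- one-dimensional face, i.e. x^v ≠ y^v and some (rational) linear functional c
-- attains its maximum over PYR(n) exactly at the vertices x^v and y^v.
Adjacent : ∀ n → Enc n → Enc n → Set
Adjacent n x y =
  charVec n x ≢ charVec n y ×
  ∃[ c ] (value n c x ≡ value n c y ×
          (∀ (z : Enc n) → value n c z ≤ℚ value n c x ×
             (value n c z ≡ value n c x → charVec n z ≡ charVec n x ⊎ charVec n z ≡ charVec n y)))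

Cond1 : ∀ n → Enc n → Enc n → Set
Cond1 n x y =
  ∃[ k ] (3 < k × k + 2 < n ×
          xc n x k ≡ xc n y k × xc n x (k + 1) ≡ xc n y (k + 1) × xc n x k ≢ xc n x (k + 1) ×
          ∃[ i ] (3 ≤ i × i < k × xc n x i ≢ xc n y i) ×
          ∃[ j ] (k + 1 < j × j + 1 ≤ n × xc n x j ≢ xc n y j))

Cond2 : ∀ n → Enc n → Enc n → Set
Cond2 n x y =
  ∃[ k ] (3 ≤ k × k + 2 < n ×
          xc n x k ≡ xc n y (k + 1) × xc n x (k + 1) ≡ xc n y k × xc n x k ≢ xc n x (k + 1) ×
          ∃[ j ] (k + 1 < j × j + 1 ≤ n × xc n x j ≡ xc n y j))

{-# OPTIONS --safe #-}
-- A pyramidal tour is read off its side function: vertex i ↦ whether i is visited in increasing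
-- order, with 1 counted as decreasing and 2 as increasing.  Apart from {1,2}, every edge joins a
-- vertex to the next vertex on its side, or to n, so the edges of a tour are determined locally by
-- the positions where its side function switches.
--
-- Conditions (1) and (2) say that x and y share a switch k while their relative orientation (do
-- they put a vertex on the same side?) at k differs from that at some vertex below k and at some
-- vertex above k + 1.  Splicing x up to k with y after k, flipped if they disagree at k, and y with
-- x likewise, gives tours z, w with x^v + y^v = z^v + w^v and z ∉ {x, y}; so no linear functional
-- is maximised exactly on the segment [x^v, y^v].
--
-- Otherwise, maximise minus the number of edges outside x ∪ y.  A maximiser z uses only edges of x
-- and y, so at each position it switches like x or like y.  Where z stops following one of them
-- and starts following the other, the edge of z over that stretch lies in x or y and forces z to
-- follow that tour at both ends, unless x and y share a switch inside the stretch; as there is no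
-- such switch, z ∈ {x, y}.

module Submission where

open import Defs

open import Algebra.Bundles using (CommutativeMonoid; CommutativeRing)
open import Data.Bool using (Bool; true; false; not; _xor_; _∧_; _∨_; T; if_then_else_)
open import Data.Bool.Properties
  using ( xor-same; xor-inverseˡ; xor-inverseʳ; xor-identityʳ; xor-assoc; xor-comm; xor-∧-commutativeRing
        ; not-distribˡ-xor; not-involutive; ¬-not; not-¬; ∧-comm; ∨-comm; ∨-assoc; ∨-identityʳ
        ; T-∧; T-∨; T-≡; T-not-≡ )
  renaming (_≟_ to _≟ᵇ_)
open import Data.Empty using (⊥-elim)
open import Data.Fin using (Fin; toℕ; fromℕ<)
open import Data.Fin.Properties using (toℕ-fromℕ<; toℕ-injective; toℕ<n)
open import Data.List using (List; []; _∷_; _++_; map; reverse; foldr; applyUpTo)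
open import Data.List.Membership.Propositional using (_∈_; find; lose)
open import Data.List.Membership.Propositional.Properties
  using (∈-map⁺; ∈-map⁻; ∈-upTo⁺; ∈-upTo⁻; ∈-concatMap⁺; ∈-concatMap⁻)
open import Data.List.Properties using (∷-injective; reverse-++; map-upTo)
open import Data.List.Relation.Unary.Any using (here; there)
open import Data.Nat using (ℕ; zero; suc; _+_; _∸_; _≤_; _<_; _≡ᵇ_; z≤n; s≤s; _≤?_; _<?_)
open import Data.Nat.Properties
open import Data.Product using (_×_; _,_; proj₁; proj₂; ∃; ∃-syntax; ∃₂)
open import Data.Rational using (ℚ; 0ℚ; 1ℚ; -_) renaming (_+_ to _+ℚ_; _*_ to _*ℚ_; _≤_ to _≤ℚ_)
import Data.Rational.Properties as ℚ
import Data.Sum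
open import Data.Sum using (_⊎_; inj₁; inj₂; [_,_]′)
open import Data.Sum.Function.Propositional using (_⊎-⇔_)
open import Data.Vec using (lookup; tabulate)
open import Data.Vec.Properties using (lookup∘tabulate; tabulate∘lookup; tabulate-cong; ≡-dec)
open import Function using (_∘_)
open import Function.Bundles using (_⇔_; mk⇔; Equivalence)
open import Function.Properties.Equivalence using () renaming (refl to ⇔-refl; trans to ⇔-trans; sym to ⇔-sym)
open import Relation.Binary.Definitions using (tri<; tri≈; tri>)
open import Relation.Binary.PropositionalEquality
open import Relation.Nullary using (¬_; Dec; yes; no; does; contradiction)
open import Relation.Nullary.Decidable using (decidable-stable; ¬?; _×-dec_; toWitness)
open import Relation.Unary using (Decidable)

open import Algebra.Properties.CommutativeSemigroup
  (CommutativeMonoid.commutativeSemigroup ℚ.+-0-commutativeMonoid) using (interchange)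
open import Algebra.Properties.CommutativeSemigroup
  (CommutativeMonoid.commutativeSemigroup (CommutativeRing.+-commutativeMonoid xor-∧-commutativeRing))
  using () renaming (interchange to xor-interchange)

private variable
  n a b c i k m q r s t lo hi : ℕ
  d : Bool

xor≡true⇒≢ : ∀ {x y} → x xor y ≡ true → x ≢ y
xor≡true⇒≢ {x} eq refl = contradiction (trans (sym (xor-same x)) eq) λ ()

≢⇒xor≡true : ∀ {x y} → x ≢ y → x xor y ≡ true
≢⇒xor≡true {x} x≢y = trans (cong (x xor_) (¬-not (x≢y ∘ sym))) (xor-inverseʳ x)

≡⇒xor≡false : ∀ {x y} → x ≡ y → x xor y ≡ false
≡⇒xor≡false {x} refl = xor-same x

xor≡false⇒≡ : ∀ {x y} → x xor y ≡ false → x ≡ y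
xor≡false⇒≡ {x} {y} eq =
  decidable-stable (x ≟ᵇ y) λ x≢y → contradiction (trans (sym eq) (≢⇒xor≡true x≢y)) λ ()

xor-cancelˡ : ∀ x y → x xor (x xor y) ≡ y
xor-cancelˡ x y = trans (sym (xor-assoc x x y)) (cong (_xor y) (xor-same x))

xor-swap : ∀ {x y d} → x ≡ y xor d → y ≡ x xor d
xor-swap {y = y} {d} refl = sym (trans (xor-assoc y d d) (trans (cong (y xor_) (xor-same d)) (xor-identityʳ y)))

xor-isolate : ∀ {x y d} → x ≡ y xor d → x xor y ≡ d
xor-isolate {y = y} {d} refl = trans (xor-comm (y xor d) y) (xor-cancelˡ y d)

not≡not-xor : ∀ x y → not x ≡ not y xor (x xor y)
not≡not-xor false false = refl
not≡not-xor false true  = refl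
not≡not-xor true  false = refl
not≡not-xor true  true  = refl

T⇔⇒≡ : ∀ {p q} → T p ⇔ T q → p ≡ q
T⇔⇒≡ {false} {false} _   = refl
T⇔⇒≡ {false} {true}  p⇔q = ⊥-elim (Equivalence.from p⇔q _)
T⇔⇒≡ {true}  {false} p⇔q = ⊥-elim (Equivalence.to p⇔q _)
T⇔⇒≡ {true}  {true}  _   = refl

≡⇒T⇔ : ∀ {p q} → p ≡ q → T p ⇔ T q
≡⇒T⇔ refl = ⇔-refl

≡-transfer : ∀ {p q r s : Bool} → p ≡ q → (r ≡ p ⇔ s ≡ q) → r ≡ s
≡-transfer {p} {q} {r} p≡q r≡p⇔s≡q with r ≟ᵇ p
... | yes r≡p = trans r≡p (trans p≡q (sym (Equivalence.to r≡p⇔s≡q r≡p)))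
... | no  r≢p =
  trans (¬-not r≢p) (trans (cong not p≡q) (sym (¬-not (r≢p ∘ Equivalence.from r≡p⇔s≡q))))

data Last (P : ℕ → Set) (lo hi : ℕ) : Set where
  none  : (∀ {s} → lo ≤ s → s < hi → ¬ P s) → Last P lo hi
  found : ∀ s → lo ≤ s → s < hi → P s → (∀ {t} → s < t → t < hi → ¬ P t) → Last P lo hi

last? : {P : ℕ → Set} → Decidable P → ∀ lo hi → Last P lo hi
last? P? lo zero = none (λ _ ())
last? P? lo (suc hi) with lo ≤? hi
... | no lo≰hi = none (λ lo≤s s<1+hi _ → lo≰hi (≤-trans lo≤s (m<1+n⇒m≤n s<1+hi)))
... | yes lo≤hi with P? hi
...   | yes p = found hi lo≤hi ≤-refl p (λ hi<t t<1+hi _ → <⇒≱ hi<t (m<1+n⇒m≤n t<1+hi))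
...   | no ¬p with last? P? lo hi
...     | none ¬P = none λ lo≤s s<1+hi →
            [ ¬P lo≤s , (λ { refl → ¬p }) ]′ (m≤n⇒m<n∨m≡n (m<1+n⇒m≤n s<1+hi))
...     | found s lo≤s s<hi p ¬P = found s lo≤s (m≤n⇒m≤1+n s<hi) p λ s<t t<1+hi →
            [ ¬P s<t , (λ { refl → ¬p }) ]′ (m≤n⇒m<n∨m≡n (m<1+n⇒m≤n t<1+hi))

data First (P : ℕ → Set) (lo hi : ℕ) : Set where
  none  : (∀ {s} → lo ≤ s → s < hi → ¬ P s) → First P lo hi
  found : ∀ s → lo ≤ s → s < hi → P s → (∀ {t} → lo ≤ t → t < s → ¬ P t) → First P lo hi

first? : {P : ℕ → Set} → Decidable P → ∀ lo hi → First P lo hi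
first? P? lo zero = none (λ _ ())
first? P? lo (suc hi) with first? P? lo hi
... | found s lo≤s s<hi p ¬P = found s lo≤s (m≤n⇒m≤1+n s<hi) p ¬P
... | none ¬P with lo ≤? hi
...   | no lo≰hi = none (λ lo≤s s<1+hi _ → lo≰hi (≤-trans lo≤s (m<1+n⇒m≤n s<1+hi)))
...   | yes lo≤hi with P? hi
...     | yes p = found hi lo≤hi ≤-refl p ¬P
...     | no ¬p = none λ lo≤s s<1+hi →
            [ ¬P lo≤s , (λ { refl → ¬p }) ]′ (m≤n⇒m<n∨m≡n (m<1+n⇒m≤n s<1+hi))

-- Sides, switches and the edges they determine

Side : Set
Side = ℕ → Bool

Valid : Side → Set
Valid W = W 1 ≡ false × W 2 ≡ true

switch : Side → ℕ → Bool
switch W s = W s xor W (suc s)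

diff : Side → Side → ℕ → Bool
diff X Y i = X i xor Y i

private variable V W X Y Z : Side

switch≡true⇒≢ : switch W k ≡ true → W k ≢ W (suc k)
switch≡true⇒≢ = xor≡true⇒≢

switch≡true⇒≡not : switch W k ≡ true → W (suc k) ≡ not (W k)
switch≡true⇒≡not {W} {k} eq = ¬-not (switch≡true⇒≢ {W} {k} eq ∘ sym)

diff-suc : ∀ X Y t → diff X Y (suc t) ≡ diff X Y t xor (switch X t xor switch Y t)
diff-suc X Y t = trans (cong₂ _xor_ (sym (xor-cancelˡ (X t) (X (suc t)))) (sym (xor-cancelˡ (Y t) (Y (suc t)))))
                       (xor-interchange (X t) _ (Y t) _)

diff-step : ∀ {X Y : Side} {t} → switch X t ≡ switch Y t → diff X Y (suc t) ≡ diff X Y t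
diff-step {X} {Y} {t} eq =
  trans (diff-suc X Y t) (trans (cong (diff X Y t xor_) (≡⇒xor≡false eq)) (xor-identityʳ _))

diff-flip : ∀ {X Y : Side} {t} → switch X t ≢ switch Y t → diff X Y (suc t) ≢ diff X Y t
diff-flip {X} {Y} {t} ne eq = not-¬ refl (begin
  diff X Y t                                 ≡⟨ sym eq ⟩
  diff X Y (suc t)                           ≡⟨ diff-suc X Y t ⟩
  diff X Y t xor (switch X t xor switch Y t) ≡⟨ cong (diff X Y t xor_) (≢⇒xor≡true ne) ⟩
  diff X Y t xor true                        ≡⟨ xor-comm _ true ⟩
  not (diff X Y t)                           ∎)
  where open ≡-Reasoning

diff-const : ∀ {X Y : Side} {u v} → u ≤ v → (∀ {t} → u ≤ t → t < v → switch X t ≡ switch Y t) →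
             diff X Y u ≡ diff X Y v
diff-const {v = zero}  z≤n _ = refl
diff-const {X} {Y} {v = suc v} u≤1+v same with m≤n⇒m<n∨m≡n u≤1+v
... | inj₂ refl    = refl
... | inj₁ u<1+v = trans (diff-const {X} {Y} (m<1+n⇒m≤n u<1+v) (λ u≤t t<v → same u≤t (m<n⇒m<1+n t<v)))
                         (sym (diff-step {X} {Y} (same (m<1+n⇒m≤n u<1+v) ≤-refl)))

NextOnSide : Side → ℕ → ℕ → ℕ → Set
NextOnSide W n a b = (b ≡ n ⊎ (b < n × W b ≡ W a)) × (∀ {i} → a < i → i < b → W i ≡ not (W a))

IsEdge : Side → ℕ → ℕ → ℕ → Set
IsEdge W n a b = (a ≡ 1 × b ≡ 2) ⊎ NextOnSide W n a b

isEdge-run : IsEdge W n a b → 3 ≤ b → a < i → i < b → W i ≡ not (W a)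
isEdge-run (inj₁ (_ , refl)) (s≤s (s≤s ()))
isEdge-run (inj₂ (_ , run))  _ = run

isEdge-end : IsEdge W n a b → 3 ≤ b → b < n → W b ≡ W a
isEdge-end (inj₁ (_ , refl))              (s≤s (s≤s ()))
isEdge-end (inj₂ (inj₁ refl , _))         _ b<n = contradiction b<n (<-irrefl refl)
isEdge-end (inj₂ (inj₂ (_ , Wb≡Wa) , _)) _ _   = Wb≡Wa

isEdge-switch : IsEdge W n m q → 3 ≤ q → m ≤ s → s < q → suc s < n →
                (m≟s : Dec (m ≡ s)) (s+1≟q : Dec (suc s ≡ q)) → switch W s ≡ does m≟s xor does s+1≟q
isEdge-switch {W} {m = m} e 3≤q m≤s s<q s+1<n (yes refl) (yes refl) =
  trans (cong (W m xor_) (isEdge-end e 3≤q s+1<n)) (xor-same (W m))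
isEdge-switch {W} {m = m} e 3≤q m≤s s<q s+1<n (yes refl) (no s+1≢q) =
  trans (cong (W m xor_) (isEdge-run e 3≤q ≤-refl (≤∧≢⇒< s<q s+1≢q))) (xor-inverseʳ (W m))
isEdge-switch {W} {m = m} e 3≤q m≤s s<q s+1<n (no m≢s) (yes refl) =
  trans (cong₂ _xor_ (isEdge-run e 3≤q (≤∧≢⇒< m≤s m≢s) ≤-refl) (isEdge-end e 3≤q s+1<n))
        (xor-inverseˡ (W m))
isEdge-switch {W} {m = m} {s = s} e 3≤q m≤s s<q s+1<n (no m≢s) (no s+1≢q) =
  trans (cong₂ _xor_ (isEdge-run e 3≤q m<s s<q)
                     (isEdge-run e 3≤q (<-trans m<s (n<1+n s)) (≤∧≢⇒< s<q s+1≢q)))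
        (xor-same (not (W m)))
  where m<s = ≤∧≢⇒< m≤s m≢s

isEdge-switch-agree : IsEdge V n m q → IsEdge W n m q → 3 ≤ q → m ≤ s → s < q → suc s < n →
                      switch V s ≡ switch W s
isEdge-switch-agree eV eW 3≤q m≤s s<q s+1<n =
  trans (isEdge-switch eV 3≤q m≤s s<q s+1<n (_ ≟ _) (_ ≟ _))
        (sym (isEdge-switch eW 3≤q m≤s s<q s+1<n (_ ≟ _) (_ ≟ _)))

isEdge-blocked : W k ≢ W (suc k) → a < k → suc k < b → ¬ IsEdge W n a b
isEdge-blocked {k = k} Wk≢Wk+1 a<k k+1<b e =
  Wk≢Wk+1 (trans (isEdge-run e 3≤b a<k (<-trans (n<1+n k) k+1<b))
                 (sym (isEdge-run e 3≤b (<-trans a<k (n<1+n k)) k+1<b)))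
  where 3≤b = ≤-trans (s≤s (s≤s (≤-trans (s≤s z≤n) a<k))) k+1<b

isEdge-consecutive : 2 ≤ k → suc k < n → IsEdge W n k (suc k) ⇔ W (suc k) ≡ W k
isEdge-consecutive 2≤k k+1<n = mk⇔ (λ e → isEdge-end e (s≤s 2≤k) k+1<n)
  λ Wk+1≡Wk → inj₂ (inj₂ (k+1<n , Wk+1≡Wk) , λ k<i i<k+1 → contradiction i<k+1 (<⇒≱ k<i ∘ ≤-pred))

isEdge-xor : b ≤ n → a < b → (∀ {i} → a ≤ i → i ≤ b → i < n → V i ≡ W i xor d) →
             IsEdge W n a b → IsEdge V n a b
isEdge-xor _ _ _ (inj₁ e) = inj₁ e
isEdge-xor {b} {n} {a} {V} {W} {d} b≤n a<b V≡W (inj₂ (end , run)) = inj₂ (end′ end , run′)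
  where
  open ≡-Reasoning
  Va : V a ≡ W a xor d
  Va = V≡W ≤-refl (<⇒≤ a<b) (<-≤-trans a<b b≤n)
  end′ : b ≡ n ⊎ (b < n × W b ≡ W a) → b ≡ n ⊎ (b < n × V b ≡ V a)
  end′ (inj₁ b≡n)          = inj₁ b≡n
  end′ (inj₂ (b<n , Wb≡Wa)) = inj₂ (b<n , (begin
    V b        ≡⟨ V≡W (<⇒≤ a<b) ≤-refl b<n ⟩
    W b xor d  ≡⟨ cong (_xor d) Wb≡Wa ⟩
    W a xor d  ≡⟨ Va ⟨
    V a        ∎))
  run′ : ∀ {i} → a < i → i < b → V i ≡ not (V a)
  run′ {i} a<i i<b = begin
    V i              ≡⟨ V≡W (<⇒≤ a<i) (<⇒≤ i<b) (<-≤-trans i<b b≤n) ⟩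
    W i xor d        ≡⟨ cong (_xor d) (run a<i i<b) ⟩
    not (W a) xor d  ≡⟨ not-distribˡ-xor (W a) d ⟨
    not (W a xor d)  ≡⟨ cong not Va ⟨
    not (V a)        ∎

isEdge-xor⇔ : b ≤ n → a < b → (∀ {i} → a ≤ i → i ≤ b → i < n → V i ≡ W i xor d) →
              IsEdge V n a b ⇔ IsEdge W n a b
isEdge-xor⇔ b≤n a<b V≡W = mk⇔ (isEdge-xor b≤n a<b (λ a≤i i≤b i<n → xor-swap (V≡W a≤i i≤b i<n)))
                              (isEdge-xor b≤n a<b V≡W)

-- Splicing two tours at a common switch

record Splice (X Y Z : Side) (n k : ℕ) : Set where
  field
    switchˣ : switch X k ≡ true
    switchʸ : switch Y k ≡ true
    left    : ∀ {i} → i ≤ k → Z i ≡ X i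
    right   : ∀ {i} → k < i → i < n → Z i ≡ Y i xor diff X Y k

module _ {X Y Z : Side} {n k : ℕ} (S : Splice X Y Z n k) where
  open Splice S

  splice-joint : X (suc k) ≡ Y (suc k) xor diff X Y k
  splice-joint = begin
    X (suc k)                      ≡⟨ switch≡true⇒≡not {X} switchˣ ⟩
    not (X k)                      ≡⟨ not≡not-xor (X k) (Y k) ⟩
    not (Y k) xor diff X Y k       ≡⟨ cong (_xor diff X Y k) (switch≡true⇒≡not {Y} switchʸ) ⟨
    Y (suc k) xor diff X Y k       ∎
    where open ≡-Reasoning

  splice-switch : suc k < n → Z k ≢ Z (suc k)
  splice-switch k+1<n Zk≡Zk+1 = switch≡true⇒≢ {X} switchˣ (begin
    X k                       ≡⟨ left ≤-refl ⟨
    Z k                       ≡⟨ Zk≡Zk+1 ⟩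
    Z (suc k)                 ≡⟨ right (n<1+n k) k+1<n ⟩
    Y (suc k) xor diff X Y k  ≡⟨ splice-joint ⟨
    X (suc k)                 ∎)
    where open ≡-Reasoning

  splice-left : suc k < n → a < b → b ≤ suc k → IsEdge Z n a b ⇔ IsEdge X n a b
  splice-left {a} {b} k+1<n a<b b≤k+1 = isEdge-xor⇔ (≤-trans b≤k+1 (<⇒≤ k+1<n)) a<b Z≡X
    where
    Z≡X : ∀ {i} → a ≤ i → i ≤ b → i < n → Z i ≡ X i xor false
    Z≡X {i} _ i≤b i<n with m≤n⇒m<n∨m≡n (≤-trans i≤b b≤k+1)
    ... | inj₁ i<k+1 = trans (left (m<1+n⇒m≤n i<k+1)) (sym (xor-identityʳ (X i)))
    ... | inj₂ refl  = trans (right ≤-refl i<n) (trans (sym splice-joint) (sym (xor-identityʳ (X i))))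

  splice-right : k ≤ a → a < b → b ≤ n → IsEdge Z n a b ⇔ IsEdge Y n a b
  splice-right {a} {b} k≤a a<b b≤n = isEdge-xor⇔ b≤n a<b Z≡Y
    where
    Z≡Y : ∀ {i} → a ≤ i → i ≤ b → i < n → Z i ≡ Y i xor diff X Y k
    Z≡Y a≤i _ i<n with m≤n⇒m<n∨m≡n (≤-trans k≤a a≤i)
    ... | inj₁ k<i = right k<i i<n
    ... | inj₂ refl = trans (left ≤-refl) (xor-swap (sym (xor-cancelˡ (X k) (Y k))))

-- No edge passes over a switch, so each edge lies within [0, k + 1] or within [k, n].
splice-edges : Splice X Y Z n k → Splice Y X W n k → suc k < n → a < b → b ≤ n →
  (IsEdge Z n a b ⇔ IsEdge X n a b × IsEdge W n a b ⇔ IsEdge Y n a b) ⊎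
  (IsEdge Z n a b ⇔ IsEdge Y n a b × IsEdge W n a b ⇔ IsEdge X n a b)
splice-edges {X} {Y} {n = n} {k} {a = a} {b} S S′ k+1<n a<b b≤n with b ≤? suc k | k ≤? a
... | yes b≤k+1 | _      = inj₁ (splice-left S k+1<n a<b b≤k+1 , splice-left S′ k+1<n a<b b≤k+1)
... | no _     | yes k≤a = inj₂ (splice-right S k≤a a<b b≤n , splice-right S′ k≤a a<b b≤n)
... | no b≰k+1 | no k≰a  =
  inj₁ ( both-absent (splice-switch S k+1<n) (switch≡true⇒≢ {X} (Splice.switchˣ S))
       , both-absent (splice-switch S′ k+1<n) (switch≡true⇒≢ {Y} (Splice.switchˣ S′)))
  where
  both-absent : ∀ {V W} → V k ≢ V (suc k) → W k ≢ W (suc k) → IsEdge V n a b ⇔ IsEdge W n a b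
  both-absent Vk≢Vk+1 Wk≢Wk+1 = mk⇔ (⊥-elim ∘ isEdge-blocked Vk≢Vk+1 (≰⇒> k≰a) (≰⇒> b≰k+1))
                                     (⊥-elim ∘ isEdge-blocked Wk≢Wk+1 (≰⇒> k≰a) (≰⇒> b≰k+1))

-- A tour whose edges are covered by two others

differsBefore : Valid Z → 2 ≤ t → ∃[ s ] (1 ≤ s × s < t × Z s ≢ Z t)
differsBefore {Z} {t} (Z1≡false , Z2≡true) 2≤t with Z t ≟ᵇ true
... | yes Zt≡true =
  1 , ≤-refl , 2≤t , λ Z1≡Zt → contradiction (trans (sym Z1≡false) (trans Z1≡Zt Zt≡true)) λ ()
... | no Zt≢true  = 2 , s≤s z≤n , 2<t , λ Z2≡Zt → Zt≢true (trans (sym Z2≡Zt) Z2≡true)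
  where 2<t = ≤∧≢⇒< 2≤t λ { refl → Zt≢true Z2≡true }

run-extend : ∀ {W : Side} {m t q i : ℕ} → (∀ {j} → m < j → j ≤ t → W j ≡ not (W m)) →
             (∀ {j} → suc t ≤ j → j < q → W j ≢ W m) → m < i → i < q → W i ≡ not (W m)
run-extend {t = t} {i = i} before after m<i i<q with i ≤? t
... | yes i≤t = before m<i i≤t
... | no i≰t  = ¬-not (after (≰⇒> i≰t) i<q)

run⇒edge : m < t → t < n → (∀ {i} → m < i → i ≤ t → Z i ≡ not (Z m)) →
           ∃[ q ] (t < q × q ≤ n × IsEdge Z n m q)
run⇒edge {m} {t} {n} {Z} m<t t<n before with first? (λ i → Z i ≟ᵇ Z m) (suc t) n
... | none after                  = n , t<n , ≤-refl , inj₂ (inj₁ refl , run-extend before after)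
... | found q t<q q<n Zq≡Zm after = q , t<q , <⇒≤ q<n , inj₂ (inj₂ (q<n , Zq≡Zm) , run-extend before after)

edgeOver : Valid Z → 2 ≤ t → t < n → ∃₂ λ m q → 1 ≤ m × m < t × t < q × q ≤ n × IsEdge Z n m q
edgeOver {Z} {t} {n} vZ 2≤t t<n with last? (λ i → ¬? (Z i ≟ᵇ Z t)) 1 t
... | none sameAsT =
  let s , 1≤s , s<t , Zs≢Zt = differsBefore {Z} vZ 2≤t in contradiction Zs≢Zt (sameAsT 1≤s s<t)
... | found m 1≤m m<t Zm≢Zt sameAsT =
  let q , t<q , q≤n , e = run⇒edge m<t t<n before in m , q , 1≤m , m<t , t<q , q≤n , e
  where
  before : ∀ {i} → m < i → i ≤ t → Z i ≡ not (Z m)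
  before {i} m<i i≤t = trans Zi≡Zt (¬-not (Zm≢Zt ∘ sym))
    where
    Zi≡Zt : Z i ≡ Z t
    Zi≡Zt with m≤n⇒m<n∨m≡n i≤t
    ... | inj₁ i<t = decidable-stable (Z i ≟ᵇ Z t) (sameAsT m<i i<t)
    ... | inj₂ refl = refl

Covered : Side → Side → Side → ℕ → Set
Covered X Y Z n = ∀ {a b} → 1 ≤ a → a < b → b ≤ n → IsEdge Z n a b → IsEdge X n a b ⊎ IsEdge Y n a b

covered-sym : Covered X Y Z n → Covered Y X Z n
covered-sym cov 1≤a a<b b≤n e = Data.Sum.swap (cov 1≤a a<b b≤n e)

-- The edge of Z over c starts at or before a, as Z does not switch in between, and the tour
-- containing it switches like Z along the whole edge.
covered-stretch : Valid Z → Covered X Y Z n → 2 ≤ a → a ≤ c → suc c < n →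
                  (∀ {t} → a < t → t < c → switch Z t ≡ false) →
                  (switch Z a ≡ switch X a × switch Z c ≡ switch X c) ⊎
                  (switch Z a ≡ switch Y a × switch Z c ≡ switch Y c)
covered-stretch {Z} {X} {Y} {n} {a} {c} vZ cov 2≤a a≤c c+1<n quiet
  with edgeOver vZ (≤-trans 2≤a a≤c) (<-trans (n<1+n c) c+1<n)
... | m , q , 1≤m , m<c , c<q , q≤n , edgeZ =
  Data.Sum.map agree agree (cov 1≤m (<-trans m<c c<q) q≤n edgeZ)
  where
  3≤q : 3 ≤ q
  3≤q = <-≤-trans (s≤s (≤-trans 2≤a a≤c)) c<q
  m≤a : m ≤ a
  m≤a with m ≤? a
  ... | yes m≤a = m≤a
  ... | no m≰a  =
    contradiction (quiet (≰⇒> m≰a) m<c) (λ Zm≡false → contradiction (trans (sym Zm≡false) Zm-switch) λ ())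
    where
    Zm-switch : switch Z m ≡ true
    Zm-switch = trans (cong (Z m xor_) (isEdge-run edgeZ 3≤q (n<1+n m) (≤-<-trans m<c c<q))) (xor-inverseʳ (Z m))
  agree : ∀ {W} → IsEdge W n m q → switch Z a ≡ switch W a × switch Z c ≡ switch W c
  agree e = isEdge-switch-agree edgeZ e 3≤q m≤a (≤-<-trans a≤c c<q) (≤-<-trans (s≤s a≤c) c+1<n)
          , isEdge-switch-agree edgeZ e 3≤q (<⇒≤ m<c) c<q c+1<n

switch-inherited : Valid Z → Covered X Y Z n → 2 ≤ s → suc s < n →
                   switch Z s ≡ switch X s ⊎ switch Z s ≡ switch Y s
switch-inherited vZ cov 2≤s s+1<n =
  Data.Sum.map proj₁ proj₁
    (covered-stretch vZ cov 2≤s ≤-refl s+1<n (λ s<t t<s → contradiction s<t (<-asym t<s)))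

SeparatingSwitch : Side → Side → ℕ → Set
SeparatingSwitch X Y n =
  ∃ λ k → k < n × switch X k ≡ true × switch Y k ≡ true ×
    (∃ λ i → i < k × 2 ≤ i × diff X Y i ≢ diff X Y k) ×
    (∃ λ j → j < n × suc k < j × diff X Y j ≢ diff X Y k)

separatingSwitch? : ∀ X Y n → Dec (SeparatingSwitch X Y n)
separatingSwitch? X Y n = anyUpTo? (λ k →
  switch X k ≟ᵇ true ×-dec switch Y k ≟ᵇ true ×-dec
  anyUpTo? (λ i → 2 ≤? i ×-dec ¬? (diff X Y i ≟ᵇ diff X Y k)) k ×-dec
  anyUpTo? (λ j → suc k <? j ×-dec ¬? (diff X Y j ≟ᵇ diff X Y k)) n) n

separatingSwitch-sym : SeparatingSwitch X Y n → SeparatingSwitch Y X n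
separatingSwitch-sym {X} {Y} (k , k<n , sX , sY , (i , i<k , 2≤i , Di≢Dk) , (j , j<n , k+1<j , Dj≢Dk)) =
  k , k<n , sY , sX , (i , i<k , 2≤i , swap Di≢Dk) , (j , j<n , k+1<j , swap Dj≢Dk)
  where
  swap : ∀ {p q} → diff X Y p ≢ diff X Y q → diff Y X p ≢ diff Y X q
  swap {p} {q} ne eq = ne (trans (xor-comm (X p) (Y p)) (trans eq (xor-comm (Y q) (X q))))

record LastSwitchMismatch (Z X : Side) (n a : ℕ) : Set where
  field
    2≤a     : 2 ≤ a
    a+1<n   : suc a < n
    differs : switch Z a ≢ switch X a
    agrees  : ∀ {s} → a < s → suc s < n → switch Z s ≡ switch X s

lastSwitchMismatch : Valid X → Valid Z → ∃[ i ] (i < n × 2 ≤ i × Z i ≢ X i) →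
                     ∃[ a ] LastSwitchMismatch Z X n a
lastSwitchMismatch {X} {Z} {n} (X1 , X2) (Z1 , Z2) (i , i<n , 2≤i , Zi≢Xi)
  with last? (λ s → suc s <? n ×-dec ¬? (switch Z s ≟ᵇ switch X s)) 2 n
... | found a 2≤a _ (a+1<n , differs) later = a , record
  { 2≤a = 2≤a ; a+1<n = a+1<n ; differs = differs
  ; agrees = λ a<s s+1<n → decidable-stable (_ ≟ᵇ _) λ ne → later a<s (<-trans (n<1+n _) s+1<n) (s+1<n , ne) }
... | none agree = contradiction (xor≡false⇒≡ (trans (sym (diff-const {Z} {X} 2≤i same)) D2≡false)) Zi≢Xi
  where
  same : ∀ {t} → 2 ≤ t → t < i → switch Z t ≡ switch X t
  same {t} 2≤t t<i = decidable-stable (_ ≟ᵇ _) λ ne → agree 2≤t (<-trans t<i i<n) (≤-<-trans t<i i<n , ne)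
  D2≡false : diff Z X 2 ≡ false
  D2≡false = trans (cong₂ _xor_ Z2 X2) refl

commonSwitch⇒separatingSwitch : 2 ≤ a → a < r → r < c → suc c < n → switch X r ≡ true →
                                (∀ {t} → a < t → t < c → switch X t ≡ switch Y t) →
                                switch X a ≢ switch Y a → switch X c ≢ switch Y c → SeparatingSwitch X Y n
commonSwitch⇒separatingSwitch {a} {r} {c} {n} {X} {Y} 2≤a a<r r<c c+1<n Xr X≡Y Xa≢Ya Xc≢Yc =
  r , <-trans r<c (<-trans (n<1+n c) c+1<n) , Xr , trans (sym (X≡Y a<r r<c)) Xr ,
  (a , a<r , 2≤a , Da≢Dr) , (suc c , c+1<n , s≤s r<c , Dc+1≢Dr)
  where
  Da+1≡Dr : diff X Y (suc a) ≡ diff X Y r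
  Da+1≡Dr = diff-const {X} {Y} a<r λ a<t t<r → X≡Y a<t (<-trans t<r r<c)
  Dr≡Dc : diff X Y r ≡ diff X Y c
  Dr≡Dc = diff-const {X} {Y} (<⇒≤ r<c) λ r≤t t<c → X≡Y (<-≤-trans a<r r≤t) t<c
  Da≢Dr : diff X Y a ≢ diff X Y r
  Da≢Dr Da≡Dr = diff-flip {X} {Y} Xa≢Ya (trans Da+1≡Dr (sym Da≡Dr))
  Dc+1≢Dr : diff X Y (suc c) ≢ diff X Y r
  Dc+1≢Dr Dc+1≡Dr = diff-flip {X} {Y} Xc≢Yc (trans Dc+1≡Dr Dr≡Dc)

-- Let c be the first position after a where Z switches unlike Y.  Strictly between a and c, X, Y
-- and Z switch alike; a common switch there is separating, and without one covered-stretch makes Z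
-- switch like X at a or like Y at c.
separatingSwitch-between : Valid Z → Covered X Y Z n → LastSwitchMismatch Z X n a →
                           suc b < n → switch Z b ≢ switch Y b → a < b → SeparatingSwitch X Y n
separatingSwitch-between {Z} {X} {Y} {n} {a} {b} vZ cov A b+1<n Zb≢Yb a<b
  with first? (λ s → ¬? (switch Z s ≟ᵇ switch Y s)) (suc a) (suc b)
... | none agreeZY = contradiction Zb≢Yb (agreeZY a<b ≤-refl)
... | found c a<c c<1+b Zc≢Yc agreeZY = gap (last? (λ t → switch X t ≟ᵇ true) (suc a) c)
  where
  open LastSwitchMismatch A
  c+1<n : suc c < n
  c+1<n = ≤-<-trans (s≤s (m<1+n⇒m≤n c<1+b)) b+1<n
  Z≡X : ∀ {t} → a < t → t < c → switch Z t ≡ switch X t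
  Z≡X a<t t<c = agrees a<t (<-trans (s≤s t<c) c+1<n)
  Xa≢Ya : switch X a ≢ switch Y a
  Xa≢Ya with switch-inherited vZ cov 2≤a a+1<n
  ... | inj₁ Za≡Xa = contradiction Za≡Xa differs
  ... | inj₂ Za≡Ya = λ Xa≡Ya → differs (trans Za≡Ya (sym Xa≡Ya))
  gap : Last (λ t → switch X t ≡ true) (suc a) c → SeparatingSwitch X Y n
  gap (found r a<r r<c Xr _) =
    commonSwitch⇒separatingSwitch {X = X} {Y} 2≤a a<r r<c c+1<n Xr
      (λ a<t t<c → trans (sym (Z≡X a<t t<c)) (decidable-stable (_ ≟ᵇ _) (agreeZY a<t t<c)))
      Xa≢Ya (λ Xc≡Yc → Zc≢Yc (trans (agrees a<c c+1<n) Xc≡Yc))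
  gap (none noSwitchX)
    with covered-stretch vZ cov 2≤a (<⇒≤ a<c) c+1<n
           (λ a<t t<c → trans (Z≡X a<t t<c) (¬-not (noSwitchX a<t t<c)))
  ... | inj₁ (Za≡Xa , _) = contradiction Za≡Xa differs
  ... | inj₂ (_ , Zc≡Yc) = contradiction Zc≡Yc Zc≢Yc

covered⇒separatingSwitch : Valid X → Valid Y → Valid Z → Covered X Y Z n →
                           ∃[ i ] (i < n × 2 ≤ i × Z i ≢ X i) → ∃[ i ] (i < n × 2 ≤ i × Z i ≢ Y i) →
                           SeparatingSwitch X Y n
covered⇒separatingSwitch {X} {Y} {Z} {n} vX vY vZ cov Z≢X Z≢Y =
  compare (lastSwitchMismatch vX vZ Z≢X) (lastSwitchMismatch vY vZ Z≢Y)
  where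
  open LastSwitchMismatch
  compare : ∃ (LastSwitchMismatch Z X n) → ∃ (LastSwitchMismatch Z Y n) → SeparatingSwitch X Y n
  compare (a , A) (b , B) with <-cmp a b
  ... | tri< a<b _ _  = separatingSwitch-between vZ cov A (a+1<n B) (differs B) a<b
  ... | tri> _ _ b<a  = separatingSwitch-sym {Y} {X}
                          (separatingSwitch-between vZ (covered-sym cov) B (a+1<n A) (differs A) b<a)
  ... | tri≈ _ refl _ = ⊥-elim ([ differs A , differs B ]′ (switch-inherited vZ cov (2≤a A) (a+1<n A)))

-- Cond1 n x y and Cond2 n x y are Cond1ᶠ and Cond2ᶠ at W = xc n x, V = xc n y.
Cond1ᶠ : Side → Side → ℕ → Set
Cond1ᶠ W V n =
  ∃[ k ] (3 < k × k + 2 < n ×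
          W k ≡ V k × W (k + 1) ≡ V (k + 1) × W k ≢ W (k + 1) ×
          ∃[ i ] (3 ≤ i × i < k × W i ≢ V i) ×
          ∃[ j ] (k + 1 < j × j + 1 ≤ n × W j ≢ V j))

Cond2ᶠ : Side → Side → ℕ → Set
Cond2ᶠ W V n =
  ∃[ k ] (3 ≤ k × k + 2 < n ×
          W k ≡ V (k + 1) × W (k + 1) ≡ V k × W k ≢ W (k + 1) ×
          ∃[ j ] (k + 1 < j × j + 1 ≤ n × W j ≡ V j))

Condᶠ : Side → Side → ℕ → Set
Condᶠ W V n = Cond1ᶠ W V n ⊎ Cond2ᶠ W V n

+1≡suc : ∀ m → m + 1 ≡ suc m
+1≡suc m = +-comm m 1

separatingSwitch⇒cond : X 2 ≡ Y 2 → SeparatingSwitch X Y n → Condᶠ X Y n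
separatingSwitch⇒cond {X} {Y} {n} X2≡Y2
  (k , _ , sX , sY , (i , i<k , 2≤i , Di≢Dk) , (j , j<n , k+1<j , Dj≢Dk)) = byDk (diff X Y k) refl
  where
  k+2<n : k + 2 < n
  k+2<n = subst (_< n) (sym (+-comm k 2)) (≤-<-trans k+1<j j<n)
  k+1<j′ : k + 1 < j
  k+1<j′ = subst (_< j) (sym (+1≡suc k)) k+1<j
  j+1≤n : j + 1 ≤ n
  j+1≤n = subst (_≤ n) (sym (+1≡suc j)) j<n
  at+1 : ∀ (W : Side) → W (k + 1) ≡ W (suc k)
  at+1 W = cong W (+1≡suc k)
  Xk≢Xk+1 : X k ≢ X (k + 1)
  Xk≢Xk+1 e = switch≡true⇒≢ {X} sX (trans e (at+1 X))
  Dk+1≡Dk : diff X Y (suc k) ≡ diff X Y k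
  Dk+1≡Dk = diff-step {X} {Y} (trans sX (sym sY))
  byDk : ∀ d → diff X Y k ≡ d → Condᶠ X Y n
  byDk false Dk = inj₁ (k , ≤-<-trans 3≤i i<k , k+2<n , xor≡false⇒≡ Dk ,
                        xor≡false⇒≡ (trans (cong (diff X Y) (+1≡suc k)) (trans Dk+1≡Dk Dk)) , Xk≢Xk+1 ,
                        (i , (3≤i , i<k , Di≢Dk ∘ differ) , (j , k+1<j′ , j+1≤n , Dj≢Dk ∘ differ)))
    where
    differ : ∀ {p} → X p ≡ Y p → diff X Y p ≡ diff X Y k
    differ e = trans (≡⇒xor≡false e) (sym Dk)
    3≤i : 3 ≤ i
    3≤i = ≤∧≢⇒< 2≤i λ { refl → Di≢Dk (differ X2≡Y2) }
  byDk true Dk = inj₂ (k , ≤-trans (s≤s 2≤i) i<k , k+2<n ,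
                       trans Xk≡notYk (trans (sym (switch≡true⇒≡not {Y} sY)) (sym (at+1 Y))) ,
                       trans (at+1 X) (trans (switch≡true⇒≡not {X} sX)
                                             (trans (cong not Xk≡notYk) (not-involutive (Y k)))) ,
                       Xk≢Xk+1 ,
                       (j , k+1<j′ , j+1≤n , xor≡false⇒≡ (¬-not λ Dj≡true → Dj≢Dk (trans Dj≡true (sym Dk)))))
    where
    Xk≡notYk : X k ≡ not (Y k)
    Xk≡notYk = ¬-not (xor≡true⇒≢ Dk)

cond⇒separatingSwitch : X 2 ≡ Y 2 → Condᶠ X Y n → SeparatingSwitch X Y n
cond⇒separatingSwitch {X} {Y} {n} _
  (inj₁ (k , 3<k , k+2<n , Xk≡Yk , Xk+1≡Yk+1 , Xk≢Xk+1 ,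
         (i , (3≤i , i<k , Xi≢Yi) , (j , k+1<j , j+1≤n , Xj≢Yj)))) =
  k , ≤-<-trans (m≤m+n k 2) k+2<n , ≢⇒xor≡true Xk≢X[k+1] , ≢⇒xor≡true Yk≢Y[k+1] ,
  (i , i<k , ≤-trans (n≤1+n 2) 3≤i , differs Xi≢Yi) ,
  (j , subst (_≤ n) (+1≡suc j) j+1≤n , subst (_< j) (+1≡suc k) k+1<j , differs Xj≢Yj)
  where
  Xk≢X[k+1] : X k ≢ X (suc k)
  Xk≢X[k+1] = subst (λ t → X k ≢ X t) (+1≡suc k) Xk≢Xk+1
  Yk≢Y[k+1] : Y k ≢ Y (suc k)
  Yk≢Y[k+1] e = Xk≢Xk+1 (trans Xk≡Yk (trans e (trans (cong Y (sym (+1≡suc k))) (sym Xk+1≡Yk+1))))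
  differs : ∀ {p} → X p ≢ Y p → diff X Y p ≢ diff X Y k
  differs ne e = contradiction (trans (sym (≢⇒xor≡true ne)) (trans e (≡⇒xor≡false Xk≡Yk))) λ ()
cond⇒separatingSwitch {X} {Y} {n} X2≡Y2
  (inj₂ (k , 3≤k , k+2<n , Xk≡Yk+1 , Xk+1≡Yk , Xk≢Xk+1 , (j , k+1<j , j+1≤n , Xj≡Yj))) =
  k , ≤-<-trans (m≤m+n k 2) k+2<n , ≢⇒xor≡true Xk≢X[k+1] , ≢⇒xor≡true Yk≢Y[k+1] ,
  (2 , 3≤k , ≤-refl , agreeing X2≡Y2) ,
  (j , subst (_≤ n) (+1≡suc j) j+1≤n , subst (_< j) (+1≡suc k) k+1<j , agreeing Xj≡Yj)
  where
  Xk≢X[k+1] : X k ≢ X (suc k)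
  Xk≢X[k+1] = subst (λ t → X k ≢ X t) (+1≡suc k) Xk≢Xk+1
  Yk≢Y[k+1] : Y k ≢ Y (suc k)
  Yk≢Y[k+1] e = Xk≢Xk+1 (trans Xk≡Yk+1 (trans (cong Y (+1≡suc k)) (trans (sym e) (sym Xk+1≡Yk))))
  agreeing : ∀ {p} → X p ≡ Y p → diff X Y p ≢ diff X Y k
  agreeing e e′ = Xk≢Xk+1 (trans (xor≡false⇒≡ (trans (sym e′) (≡⇒xor≡false e))) (sym Xk+1≡Yk))

cond-cong : ∀ {W W′ V V′ : Side} → (∀ {i} → 3 ≤ i → W i ≡ W′ i) → (∀ {i} → 3 ≤ i → V i ≡ V′ i) →
            Condᶠ W V n → Condᶠ W′ V′ n
cond-cong {W = W} {W′} {V} {V′} W≈ V≈ = Data.Sum.map cond1 cond2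
  where
  WV≡ : ∀ {p q} → 3 ≤ p → 3 ≤ q → W p ≡ V q → W′ p ≡ V′ q
  WV≡ 3≤p 3≤q e = trans (sym (W≈ 3≤p)) (trans e (V≈ 3≤q))
  WV≢ : ∀ {p} → 3 ≤ p → W p ≢ V p → W′ p ≢ V′ p
  WV≢ 3≤p ne e = ne (trans (W≈ 3≤p) (trans e (sym (V≈ 3≤p))))
  WW≢ : ∀ {p q} → 3 ≤ p → 3 ≤ q → W p ≢ W q → W′ p ≢ W′ q
  WW≢ 3≤p 3≤q ne e = ne (trans (W≈ 3≤p) (trans e (sym (W≈ 3≤q))))
  3≤+1 : ∀ {k} → 3 ≤ k → 3 ≤ k + 1
  3≤+1 {k} 3≤k = ≤-trans 3≤k (m≤m+n k 1)
  cond1 : Cond1ᶠ W V _ → Cond1ᶠ W′ V′ _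
  cond1 (k , 3<k , k+2<n , e₁ , e₂ , ne , (i , (3≤i , i<k , ne′) , (j , k+1<j , j+1≤n , ne″))) =
    k , 3<k , k+2<n , WV≡ 3≤k 3≤k e₁ , WV≡ (3≤+1 3≤k) (3≤+1 3≤k) e₂ , WW≢ 3≤k (3≤+1 3≤k) ne ,
    (i , (3≤i , i<k , WV≢ 3≤i ne′) , (j , k+1<j , j+1≤n , WV≢ 3≤j ne″))
    where
    3≤k = <⇒≤ 3<k
    3≤j = ≤-trans (3≤+1 3≤k) (<⇒≤ k+1<j)
  cond2 : Cond2ᶠ W V _ → Cond2ᶠ W′ V′ _
  cond2 (k , 3≤k , k+2<n , e₁ , e₂ , ne , (j , k+1<j , j+1≤n , e₃)) =
    k , 3≤k , k+2<n , WV≡ 3≤k (3≤+1 3≤k) e₁ , WV≡ (3≤+1 3≤k) 3≤k e₂ , WW≢ 3≤k (3≤+1 3≤k) ne ,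
    (j , k+1<j , j+1≤n , WV≡ 3≤j 3≤j e₃)
    where 3≤j = ≤-trans (3≤+1 3≤k) (<⇒≤ k+1<j)

-- Encodings and tour sequences

side : ∀ n → Enc n → Side
side n x 0 = false
side n x 1 = false
side n x 2 = true
side n x (suc (suc (suc i))) = xc n x (3 + i)

side≡xc : (x : Enc n) → 3 ≤ i → side n x i ≡ xc n x i
side≡xc x (s≤s (s≤s (s≤s _))) = refl

xc-lookup : (x : Enc n) (t : Fin (n ∸ 3)) → xc n x (toℕ t + 3) ≡ lookup x t
xc-lookup {n} x t with 3 ≤? toℕ t + 3 | toℕ t + 3 ∸ 3 <? n ∸ 3
... | yes _  | yes p  = cong (lookup x) (toℕ-injective (trans (toℕ-fromℕ< p) (m+n∸n≡m (toℕ t) 3)))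
... | no 3≰  | _      = contradiction (m≤n+m 3 (toℕ t)) 3≰
... | yes _  | no ¬p  = contradiction (subst (_< n ∸ 3) (sym (m+n∸n≡m (toℕ t) 3)) (toℕ<n t)) ¬p

toℕ+3<n : (t : Fin (n ∸ 3)) → toℕ t + 3 < n
toℕ+3<n {n} t = ≤-trans (+-monoˡ-≤ 3 (toℕ<n t)) (≤-reflexive (m∸n+n≡m 3≤n))
  where
  3≤n : 3 ≤ n
  3≤n = ≮⇒≥ λ n<3 → contradiction (subst Fin (m≤n⇒m∸n≡0 (<⇒≤ n<3)) t) λ ()

xc-injective : {x y : Enc n} → (∀ {i} → 3 ≤ i → i < n → xc n x i ≡ xc n y i) → x ≡ y
xc-injective {n} {x} {y} agree = begin
  x                    ≡⟨ tabulate∘lookup x ⟨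
  tabulate (lookup x)  ≡⟨ tabulate-cong (λ t → trans (sym (xc-lookup {n} x t))
                            (trans (agree (m≤n+m 3 (toℕ t)) (toℕ+3<n t)) (xc-lookup {n} y t))) ⟩
  tabulate (lookup y)  ≡⟨ tabulate∘lookup y ⟩
  y                    ∎
  where open ≡-Reasoning

side-injective : {x y : Enc n} → (∀ {i} → 3 ≤ i → i < n → side n x i ≡ side n y i) → x ≡ y
side-injective {x = x} {y} agree =
  xc-injective λ 3≤i i<n → trans (sym (side≡xc x 3≤i)) (trans (agree 3≤i i<n) (side≡xc y 3≤i))

differ-somewhere : {x y : Enc n} → x ≢ y → ∃[ i ] (i < n × 2 ≤ i × side n x i ≢ side n y i)
differ-somewhere {n} {x} {y} x≢y with anyUpTo? (λ i → 2 ≤? i ×-dec ¬? (side n x i ≟ᵇ side n y i)) n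
... | yes d = d
... | no ¬d = contradiction (side-injective λ {i} 3≤i i<n → decidable-stable (_ ≟ᵇ _)
                              λ ne → ¬d (i , i<n , ≤-trans (n≤1+n 2) 3≤i , ne)) x≢y

fromSide : ∀ n → Side → Enc n
fromSide n W = tabulate (λ t → W (toℕ t + 3))

side-fromSide : ∀ {W} → 3 ≤ i → i < n → side n (fromSide n W) i ≡ W i
side-fromSide {i} {n} {W} 3≤i i<n = trans (side≡xc (fromSide n W) 3≤i) xc-fromSide
  where
  xc-fromSide : xc n (fromSide n W) i ≡ W i
  xc-fromSide with 3 ≤? i | i ∸ 3 <? n ∸ 3
  ... | yes _ | yes p = trans (lookup∘tabulate _ (fromℕ< p))
                              (cong W (trans (cong (_+ 3) (toℕ-fromℕ< p)) (m∸n+n≡m 3≤i)))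
  ... | no 3≰i | _     = contradiction 3≤i 3≰i
  ... | yes _  | no ¬p = contradiction (∸-monoˡ-< i<n 3≤i) ¬p

sameEdge : ℕ → ℕ → ℕ → ℕ → Bool
sameEdge a b u v = ((u ≡ᵇ a) ∧ (v ≡ᵇ b)) ∨ ((u ≡ᵇ b) ∧ (v ≡ᵇ a))

linked : ℕ → ℕ → List ℕ → Bool
linked a b (u ∷ v ∷ l) = sameEdge a b u v ∨ linked a b (v ∷ l)
linked a b _           = false

sameEdge-sym : ∀ a b u v → sameEdge a b u v ≡ sameEdge a b v u
sameEdge-sym a b u v = trans (∨-comm ((u ≡ᵇ a) ∧ (v ≡ᵇ b)) _)
                             (cong₂ _∨_ (∧-comm (u ≡ᵇ b) (v ≡ᵇ a)) (∧-comm (u ≡ᵇ a) (v ≡ᵇ b)))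

sameEdge⇔ : a < b → m < q → T (sameEdge a b m q) ⇔ (a ≡ m × b ≡ q)
sameEdge⇔ {a} {b} {m} {q} a<b m<q = mk⇔ to from
  where
  to : T (sameEdge a b m q) → a ≡ m × b ≡ q
  to e with Equivalence.to (T-∨ {(m ≡ᵇ a) ∧ (q ≡ᵇ b)}) e
  ... | inj₁ p = let m≡a , q≡b = Equivalence.to (T-∧ {m ≡ᵇ a}) p in
                 sym (≡ᵇ⇒≡ m a m≡a) , sym (≡ᵇ⇒≡ q b q≡b)
  ... | inj₂ p = let m≡b , q≡a = Equivalence.to (T-∧ {m ≡ᵇ b}) p in
                 contradiction (subst₂ _<_ (sym (≡ᵇ⇒≡ q a q≡a)) (sym (≡ᵇ⇒≡ m b m≡b)) a<b) (<-asym m<q)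
  from : a ≡ m × b ≡ q → T (sameEdge a b m q)
  from (refl , refl) = Equivalence.from T-∨ (inj₁ (Equivalence.from T-∧ (≡⇒≡ᵇ a a refl , ≡⇒≡ᵇ b b refl)))

inTour≡linked : (x : Enc n) → inTour n x a b ≡ linked a b (tourSeq n x)
inTour≡linked {n} {a} {b} x = go (tourSeq n x)
  where
  -- the fold defining inTour, its pattern-matching lambda spelled with projections
  go : ∀ l → foldr (λ e r → ((proj₁ e ≡ᵇ a) ∧ (proj₂ e ≡ᵇ b)) ∨ ((proj₁ e ≡ᵇ b) ∧ (proj₂ e ≡ᵇ a)) ∨ r)
                   false (steps l)
             ≡ linked a b l
  go []          = refl
  go (u ∷ [])    = refl
  go (u ∷ v ∷ l) = trans (cong (λ r → ((u ≡ᵇ a) ∧ (v ≡ᵇ b)) ∨ ((u ≡ᵇ b) ∧ (v ≡ᵇ a)) ∨ r)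
                               (go (v ∷ l)))
                         (sym (∨-assoc ((u ≡ᵇ a) ∧ (v ≡ᵇ b)) _ _))

linked-++ : ∀ xs v ys → linked a b (xs ++ v ∷ ys) ≡ linked a b (xs ++ v ∷ []) ∨ linked a b (v ∷ ys)
linked-++                 []           v ys = refl
linked-++ {a} {b}         (u ∷ [])     v ys =
  cong (_∨ linked a b (v ∷ ys)) (sym (∨-identityʳ (sameEdge a b u v)))
linked-++ {a} {b}         (u ∷ w ∷ xs) v ys =
  trans (cong (sameEdge a b u w ∨_) (linked-++ (w ∷ xs) v ys)) (sym (∨-assoc (sameEdge a b u w) _ _))

linked-reverse : ∀ l → linked a b (reverse l) ≡ linked a b l
linked-reverse []          = refl
linked-reverse (u ∷ [])    = refl
linked-reverse {a} {b} (u ∷ v ∷ l) = begin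
  linked a b (reverse (u ∷ v ∷ l))                             ≡⟨ cong (linked a b) (reverse-++ (u ∷ v ∷ []) l) ⟩
  linked a b (reverse l ++ v ∷ u ∷ [])                         ≡⟨ linked-++ (reverse l) v (u ∷ []) ⟩
  linked a b (reverse l ++ v ∷ []) ∨ (sameEdge a b v u ∨ false)
    ≡⟨ cong (λ l′ → linked a b l′ ∨ _) (reverse-++ (v ∷ []) l) ⟨
  linked a b (reverse (v ∷ l)) ∨ (sameEdge a b v u ∨ false)    ≡⟨ cong₂ _∨_ (linked-reverse (v ∷ l)) (∨-identityʳ _) ⟩
  linked a b (v ∷ l) ∨ sameEdge a b v u                        ≡⟨ ∨-comm (linked a b (v ∷ l)) _ ⟩
  sameEdge a b v u ∨ linked a b (v ∷ l)                        ≡⟨ cong (_∨ linked a b (v ∷ l)) (sameEdge-sym a b v u) ⟩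
  sameEdge a b u v ∨ linked a b (v ∷ l)                        ∎
  where open ≡-Reasoning

halfStart : Bool → ℕ
halfStart true  = 2
halfStart false = 1

matches : Bool → (ℕ → Bool) → ℕ → Bool
matches true  f i = f i
matches false f i = not (f i)

half : ∀ n → Enc n → Bool → List ℕ
half n x s = halfStart s ∷ keep (matches s (xc n x)) (range 3 n) ++ n ∷ []

inTour-halves : (x : Enc n) →
                inTour n x a b ≡ sameEdge a b 1 2 ∨ linked a b (half n x true) ∨ linked a b (half n x false)
inTour-halves {n} {a} {b} x = begin
  inTour n x a b                                      ≡⟨ inTour≡linked {n} {a} {b} x ⟩
  sameEdge a b 1 2 ∨ linked a b (2 ∷ up ++ n ∷ down′) ≡⟨ cong (sameEdge a b 1 2 ∨_) (linked-++ (2 ∷ up) n down′) ⟩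
  sameEdge a b 1 2 ∨ linked a b (half n x true) ∨ linked a b (n ∷ down′)
    ≡⟨ cong (λ r → sameEdge a b 1 2 ∨ linked a b (half n x true) ∨ r)
            (trans (cong (linked a b) reversed) (linked-reverse (half n x false))) ⟩
  sameEdge a b 1 2 ∨ linked a b (half n x true) ∨ linked a b (half n x false) ∎
  where
  open ≡-Reasoning
  up = keep (xc n x) (range 3 n)
  down = keep (λ i → not (xc n x i)) (range 3 n)
  down′ = reverse down ++ 1 ∷ []
  reversed : n ∷ down′ ≡ reverse (half n x false)
  reversed = sym (trans (reverse-++ (1 ∷ down) (n ∷ [])) (cong (n ∷_) (reverse-++ (1 ∷ []) down)))

interval : ℕ → ℕ → List ℕ
interval lo zero    = []
interval lo (suc k) = lo ∷ interval (suc lo) k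

applyUpTo≡interval : ∀ {f : ℕ → ℕ} {lo} k → (∀ t → f t ≡ lo + t) → applyUpTo f k ≡ interval lo k
applyUpTo≡interval zero _ = refl
applyUpTo≡interval {lo = lo} (suc k) f≗ =
  cong₂ _∷_ (trans (f≗ 0) (+-identityʳ lo)) (applyUpTo≡interval k λ t → trans (f≗ (suc t)) (+-suc lo t))

range≡interval : ∀ lo u → range lo u ≡ interval lo (u ∸ lo)
range≡interval lo u = trans (map-upTo (lo +_) (u ∸ lo)) (applyUpTo≡interval (u ∸ lo) λ _ → refl)

Consecutive : (ℕ → Set) → ℕ → ℕ → ℕ → ℕ → Set
Consecutive P lo u a b =
  lo ≤ a × a < u × P a × (b ≡ u ⊎ (b < u × P b)) × (∀ {i} → a < i → i < b → ¬ P i)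

consecutive-split : ∀ {P : ℕ → Set} {h c u} → P h → (∀ {i} → h < i → i < c → ¬ P i) → h < c →
                    c ≡ u ⊎ (c < u × P c) → a < b →
                    Consecutive P h u a b ⇔ ((a ≡ h × b ≡ c) ⊎ Consecutive P c u a b)
consecutive-split {a} {b} {P} {h} {c} {u} Ph gap h<c cNext a<b = mk⇔ to from
  where
  c≤u : c ≤ u
  c≤u = [ ≤-reflexive , <⇒≤ ∘ proj₁ ]′ cNext
  to : Consecutive P h u a b → (a ≡ h × b ≡ c) ⊎ Consecutive P c u a b
  to (h≤a , a<u , Pa , bNext , between) with m≤n⇒m<n∨m≡n h≤a
  ... | inj₁ h<a  = inj₂ (≮⇒≥ (λ a<c → gap h<a a<c Pa) , a<u , Pa , bNext , between)
  ... | inj₂ refl with <-cmp b c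
  ...   | tri≈ _ b≡c _ = inj₁ (refl , b≡c)
  ...   | tri< b<c _ _ = ⊥-elim ([ (λ b≡u → <⇒≱ b<c (subst (c ≤_) (sym b≡u) c≤u)) ,
                                   (λ (_ , Pb) → gap a<b b<c Pb) ]′ bNext)
  ...   | tri> _ _ c<b = ⊥-elim ([ (λ c≡u → <⇒≱ c<b (subst (b ≤_) (sym c≡u) b≤u)) ,
                                   (λ (_ , Pc) → between h<c c<b Pc) ]′ cNext)
    where b≤u = [ ≤-reflexive , <⇒≤ ∘ proj₁ ]′ bNext
  from : (a ≡ h × b ≡ c) ⊎ Consecutive P c u a b → Consecutive P h u a b
  from (inj₁ (refl , refl)) = ≤-refl , <-≤-trans h<c c≤u , Ph , cNext , gap
  from (inj₂ (c≤a , a<u , Pa , bNext , between)) = ≤-trans (<⇒≤ h<c) c≤a , a<u , Pa , bNext , between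

linked-keep⇔consecutive : ∀ {P : ℕ → Set} {Q : ℕ → Bool} {h lo u} k →
              P h → (∀ {i} → h < i → i < lo → ¬ P i) →
              (∀ {i} → lo ≤ i → i < u → P i ⇔ T (Q i)) → h < lo → lo + k ≡ u → a < b →
              T (linked a b (h ∷ keep Q (interval lo k) ++ u ∷ [])) ⇔ Consecutive P h u a b
linked-keep⇔consecutive {a} {b} {P} {Q} {h} {lo} {u} zero Ph gap _ h<lo lo+0≡u a<b = mk⇔
  (λ e → Equivalence.from split (inj₁ (Equivalence.to (sameEdge⇔ a<b h<u) (subst T (∨-identityʳ _) e))))
  (λ con → [ (λ a≡h,b≡u → subst T (sym (∨-identityʳ _)) (Equivalence.from (sameEdge⇔ a<b h<u) a≡h,b≡u)) ,
             (λ (u≤a , a<u , _) → ⊥-elim (<⇒≱ a<u u≤a)) ]′ (Equivalence.to split con))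
  where
  lo≡u = trans (sym (+-identityʳ lo)) lo+0≡u
  h<u = subst (h <_) lo≡u h<lo
  split = consecutive-split Ph (λ h<i i<u → gap h<i (subst (_ <_) (sym lo≡u) i<u)) h<u (inj₁ refl) a<b
linked-keep⇔consecutive {a} {b} {P} {Q} {h} {lo} {u} (suc k) Ph gap P⇔Q h<lo lo+k+1≡u a<b with Q lo in Qlo
... | false = linked-keep⇔consecutive k Ph gap′ (P⇔Q ∘ ≤-trans (n≤1+n lo)) (<-trans h<lo (n<1+n lo))
                          (trans (sym (+-suc lo k)) lo+k+1≡u) a<b
  where
  gap′ : ∀ {i} → h < i → i < suc lo → ¬ P i
  gap′ {i} h<i i<lo+1 Pi with m≤n⇒m<n∨m≡n (m<1+n⇒m≤n i<lo+1)
  ... | inj₁ i<lo = gap h<i i<lo Pi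
  ... | inj₂ refl = subst T Qlo (Equivalence.to (P⇔Q ≤-refl lo<u) Pi)
    where lo<u = subst (lo <_) lo+k+1≡u (m<m+n lo (s≤s z≤n))
... | true = ⇔-trans (T-∨ {sameEdge a b h lo}) (⇔-trans (sameEdge⇔ a<b h<lo ⊎-⇔ rest) (⇔-sym split))
  where
  lo<u = subst (lo <_) lo+k+1≡u (m<m+n lo (s≤s z≤n))
  Plo : P lo
  Plo = Equivalence.from (P⇔Q ≤-refl lo<u) (subst T (sym Qlo) _)
  rest = linked-keep⇔consecutive k Plo (λ lo<i i<lo+1 → contradiction lo<i (≤⇒≯ (m<1+n⇒m≤n i<lo+1)))
                     (P⇔Q ∘ ≤-trans (n≤1+n lo)) (n<1+n lo) (trans (sym (+-suc lo k)) lo+k+1≡u) a<b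
  split = consecutive-split Ph gap h<lo (inj₂ (lo<u , Plo)) a<b

ConsecutiveOnSide : Side → Bool → ℕ → ℕ → ℕ → Set
ConsecutiveOnSide W s n = Consecutive (λ i → W i ≡ s) (halfStart s) n

linked-half⇔ : 3 ≤ n → (x : Enc n) (s : Bool) → a < b →
               T (linked a b (half n x s)) ⇔ ConsecutiveOnSide (side n x) s n a b
linked-half⇔ {n} {a} {b} 3≤n x s a<b =
  subst (λ l → T (linked a b (halfStart s ∷ keep (matches s (xc n x)) l ++ n ∷ [])) ⇔
               ConsecutiveOnSide (side n x) s n a b)
        (sym (range≡interval 3 n))
        (linked-keep⇔consecutive (n ∸ 3) (side-halfStart s) (halfStart-gap s) (side⇔matches s) (halfStart<3 s)
                                 (m+[n∸m]≡n 3≤n) a<b)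
  where
  side-halfStart : ∀ s → side n x (halfStart s) ≡ s
  side-halfStart true  = refl
  side-halfStart false = refl
  halfStart<3 : ∀ s → halfStart s < 3
  halfStart<3 true  = ≤-refl
  halfStart<3 false = s≤s (s≤s z≤n)
  halfStart-gap : ∀ s {i} → halfStart s < i → i < 3 → side n x i ≢ s
  halfStart-gap true  2<i i<3 = contradiction i<3 (<⇒≱ 2<i ∘ ≤-pred)
  halfStart-gap false {suc zero} (s≤s ()) _
  halfStart-gap false {suc (suc zero)} _ _ ()
  halfStart-gap false {suc (suc (suc _))} _ (s≤s (s≤s (s≤s ())))
  side⇔matches : ∀ s {i} → 3 ≤ i → i < n → side n x i ≡ s ⇔ T (matches s (xc n x) i)
  side⇔matches true  {i} 3≤i _ =
    subst (λ v → v ≡ true ⇔ T (xc n x i)) (sym (side≡xc x 3≤i)) (⇔-sym T-≡)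
  side⇔matches false {i} 3≤i _ =
    subst (λ v → v ≡ false ⇔ T (not (xc n x i))) (sym (side≡xc x 3≤i)) (⇔-sym T-not-≡)

consecutive⇒next : ∀ {s} → ConsecutiveOnSide W s n a b → NextOnSide W n a b
consecutive⇒next (_ , _ , Wa≡s , bNext , between) =
  Data.Sum.map₂ (Data.Product.map₂ (λ Wb≡s → trans Wb≡s (sym Wa≡s))) bNext ,
  λ a<i i<b → trans (¬-not (between a<i i<b)) (cong not (sym Wa≡s))

next⇒consecutive : halfStart (W a) ≤ a → a < n → NextOnSide W n a b → ConsecutiveOnSide W (W a) n a b
next⇒consecutive start≤a a<n (bNext , run) =
  start≤a , a<n , refl , bNext , λ a<i i<b Wi≡Wa → not-¬ refl (trans (sym Wi≡Wa) (run a<i i<b))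

halfStart≤ : W 1 ≡ false → 1 ≤ a → halfStart (W a) ≤ a
halfStart≤ {W} {a} W1≡false 1≤a with W a in Wa
... | false = 1≤a
... | true  = ≤∧≢⇒< 1≤a λ { refl → contradiction (trans (sym W1≡false) Wa) λ () }

consecutive⇔next : W 1 ≡ false → 1 ≤ a → a < b → b ≤ n →
                   (ConsecutiveOnSide W true n a b ⊎ ConsecutiveOnSide W false n a b) ⇔ NextOnSide W n a b
consecutive⇔next {W} {a} {b} {n} W1≡false 1≤a a<b b≤n = mk⇔ [ consecutive⇒next , consecutive⇒next ]′ from
  where
  from : NextOnSide W n a b → ConsecutiveOnSide W true n a b ⊎ ConsecutiveOnSide W false n a b
  from next with W a | next⇒consecutive {W} (halfStart≤ {W} W1≡false 1≤a) (<-≤-trans a<b b≤n) next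
  ... | true  | c = inj₁ c
  ... | false | c = inj₂ c

inTour⇔isEdge : 3 ≤ n → (x : Enc n) → 1 ≤ a → a < b → b ≤ n → T (inTour n x a b) ⇔ IsEdge (side n x) n a b
inTour⇔isEdge {n} {a} {b} 3≤n x 1≤a a<b b≤n =
  subst (λ t → T t ⇔ IsEdge (side n x) n a b) (sym (inTour-halves {n} {a} {b} x))
    (⇔-trans (T-∨ {sameEdge a b 1 2})
      (sameEdge⇔ a<b (s≤s (s≤s z≤n)) ⊎-⇔
       ⇔-trans (T-∨ {linked a b (half n x true)})
         (⇔-trans (linked-half⇔ 3≤n x true a<b ⊎-⇔ linked-half⇔ 3≤n x false a<b)
                  (consecutive⇔next {side n x} refl 1≤a a<b b≤n))))

-- Characteristic vectors and linear functionals

∈-range⁺ : lo ≤ i → i < hi → i ∈ range lo hi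
∈-range⁺ {lo} {i} {hi} lo≤i i<hi =
  subst (_∈ range lo hi) (m+[n∸m]≡n lo≤i) (∈-map⁺ (lo +_) (∈-upTo⁺ (∸-monoˡ-< i<hi lo≤i)))

∈-range⁻ : i ∈ range lo hi → lo ≤ i × i < hi
∈-range⁻ {i} {lo} {hi} i∈ with ∈-map⁻ (lo +_) i∈
... | t , t∈ , refl = m≤m+n lo t , subst (lo + t <_) (m+[n∸m]≡n lo≤hi) (+-monoʳ-< lo t<hi∸lo)
  where
  t<hi∸lo = ∈-upTo⁻ t∈
  lo≤hi : lo ≤ hi
  lo≤hi = ≮⇒≥ λ hi<lo → contradiction (subst (t <_) (m≤n⇒m∸n≡0 (<⇒≤ hi<lo)) t<hi∸lo) λ ()

∈-edges⁺ : 1 ≤ a → a < b → b ≤ n → (a , b) ∈ edges n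
∈-edges⁺ 1≤a a<b b≤n = ∈-concatMap⁺ _ (lose (∈-range⁺ 1≤a (s≤s (≤-trans (<⇒≤ a<b) b≤n)))
                                            (∈-map⁺ _ (∈-range⁺ a<b (s≤s b≤n))))

∈-edges⁻ : (a , b) ∈ edges n → 1 ≤ a × a < b × b ≤ n
∈-edges⁻ {a} {b} {n} ab∈ with find (∈-concatMap⁻ _ {xs = range 1 (suc n)} ab∈)
... | a′ , a′∈ , ab∈′ with ∈-map⁻ (a′ ,_) ab∈′
...   | b′ , b′∈ , refl = proj₁ (∈-range⁻ {hi = suc n} a′∈) , proj₁ b∈ , ≤-pred (proj₂ b∈)
  where b∈ = ∈-range⁻ {hi = suc n} b′∈

map-≡⇒∈-≡ : ∀ {A B : Set} {f g : A → B} {l} → map f l ≡ map g l → ∀ {e} → e ∈ l → f e ≡ g e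
map-≡⇒∈-≡ {l = _ ∷ _} eq (here refl) = proj₁ (∷-injective eq)
map-≡⇒∈-≡ {l = _ ∷ _} eq (there e∈) = map-≡⇒∈-≡ (proj₂ (∷-injective eq)) e∈

indicator : Bool → ℚ
indicator b = if b then 1ℚ else 0ℚ

indicator-injective : ∀ {p q} → indicator p ≡ indicator q → p ≡ q
indicator-injective {false} {false} _ = refl
indicator-injective {true}  {true}  _ = refl

charVec-side : {u v : Enc n} → 3 ≤ n → charVec n u ≡ charVec n v → 2 ≤ i → i < n → side n u i ≡ side n v i
charVec-side {i = suc (suc zero)} _ _ _ _ = refl
charVec-side {i = suc zero} _ _ (s≤s ()) _
charVec-side {n = n} {i = suc k@(suc (suc _))} {u = u} {v} 3≤n eq _ k+1<n =
  ≡-transfer (charVec-side 3≤n eq (s≤s (s≤s z≤n)) (<-trans (n<1+n k) k+1<n))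
             (⇔-trans (edge⇔ u) (⇔-trans (≡⇒T⇔ inTour≡) (⇔-sym (edge⇔ v))))
  where
  edge⇔ : ∀ w → side n w (suc k) ≡ side n w k ⇔ T (inTour n w k (suc k))
  edge⇔ w = ⇔-sym (⇔-trans (inTour⇔isEdge 3≤n w (s≤s z≤n) (n<1+n k) (<⇒≤ k+1<n))
                           (isEdge-consecutive (s≤s (s≤s z≤n)) k+1<n))
  inTour≡ : inTour n u k (suc k) ≡ inTour n v k (suc k)
  inTour≡ = indicator-injective (map-≡⇒∈-≡ eq (∈-edges⁺ (s≤s z≤n) (n<1+n k) (<⇒≤ k+1<n)))

charVec-injective : {u v : Enc n} → 3 ≤ n → charVec n u ≡ charVec n v → u ≡ v
charVec-injective 3≤n eq = side-injective λ 3≤i i<n → charVec-side 3≤n eq (≤-trans (n≤1+n 2) 3≤i) i<n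

sumℚ : List ℚ → ℚ
sumℚ = foldr _+ℚ_ 0ℚ

p≤r∧q≤r∧p+q≡r+r⇒p≡r : ∀ {p q r} → p ≤ℚ r → q ≤ℚ r → p +ℚ q ≡ r +ℚ r → p ≡ r
p≤r∧q≤r∧p+q≡r+r⇒p≡r {p} {q} {r} p≤r q≤r eq with r ℚ.≤? p
... | yes r≤p = ℚ.≤-antisym p≤r r≤p
... | no  r≰p = contradiction (ℚ.+-mono-<-≤ (ℚ.≰⇒> r≰p) q≤r) (ℚ.<-irrefl eq)

sumℚ-map-+ : ∀ {A : Set} {f g f′ g′ : A → ℚ} l → (∀ {e} → e ∈ l → f e +ℚ g e ≡ f′ e +ℚ g′ e) →
             sumℚ (map f l) +ℚ sumℚ (map g l) ≡ sumℚ (map f′ l) +ℚ sumℚ (map g′ l)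
sumℚ-map-+ [] _ = refl
sumℚ-map-+ {f = f} {g} {f′} {g′} (e ∷ l) eq = begin
  (f e +ℚ sumℚ (map f l)) +ℚ (g e +ℚ sumℚ (map g l))       ≡⟨ interchange (f e) _ (g e) _ ⟩
  (f e +ℚ g e) +ℚ (sumℚ (map f l) +ℚ sumℚ (map g l))       ≡⟨ cong₂ _+ℚ_ (eq (here refl)) (sumℚ-map-+ l (eq ∘ there)) ⟩
  (f′ e +ℚ g′ e) +ℚ (sumℚ (map f′ l) +ℚ sumℚ (map g′ l))   ≡⟨ interchange (f′ e) (g′ e) _ _ ⟩
  (f′ e +ℚ sumℚ (map f′ l)) +ℚ (g′ e +ℚ sumℚ (map g′ l))   ∎
  where open ≡-Reasoning

sumℚ≡0 : ∀ {A : Set} {f : A → ℚ} l → (∀ {e} → e ∈ l → f e ≡ 0ℚ) → sumℚ (map f l) ≡ 0ℚ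
sumℚ≡0 []      _  = refl
sumℚ≡0 (e ∷ l) f≡0 = cong₂ _+ℚ_ (f≡0 (here refl)) (sumℚ≡0 l (f≡0 ∘ there))

sumℚ≤0 : ∀ {A : Set} {f : A → ℚ} l → (∀ e → f e ≤ℚ 0ℚ) → sumℚ (map f l) ≤ℚ 0ℚ
sumℚ≤0 []      _   = ℚ.≤-refl
sumℚ≤0 (e ∷ l) f≤0 = ℚ.+-mono-≤ (f≤0 e) (sumℚ≤0 l f≤0)

sumℚ≡0⇒≡0 : ∀ {A : Set} {f : A → ℚ} l → (∀ e → f e ≤ℚ 0ℚ) → sumℚ (map f l) ≡ 0ℚ →
            ∀ {e} → e ∈ l → f e ≡ 0ℚ
sumℚ≡0⇒≡0 (e ∷ l) f≤0 s≡0 (here refl) = p≤r∧q≤r∧p+q≡r+r⇒p≡r (f≤0 e) (sumℚ≤0 l f≤0) s≡0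
sumℚ≡0⇒≡0 {f = f} (e ∷ l) f≤0 s≡0 (there e∈) =
  sumℚ≡0⇒≡0 l f≤0 (p≤r∧q≤r∧p+q≡r+r⇒p≡r (sumℚ≤0 l f≤0) (f≤0 e) (trans (ℚ.+-comm _ (f e)) s≡0)) e∈

Exchange : ∀ n → (x y z w : Enc n) → Set
Exchange n x y z w = ∀ {a b} → 1 ≤ a → a < b → b ≤ n →
  (inTour n z a b ≡ inTour n x a b × inTour n w a b ≡ inTour n y a b) ⊎
  (inTour n z a b ≡ inTour n y a b × inTour n w a b ≡ inTour n x a b)

value-exchange : ∀ {x y z w : Enc n} → Exchange n x y z w → ∀ c →
                 value n c z +ℚ value n c w ≡ value n c x +ℚ value n c y
value-exchange {n} {x} {y} {z} {w} ex c = sumℚ-map-+ (edges n) per-edge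
  where
  term : Enc n → ℕ × ℕ → ℚ
  term u (a , b) = c a b *ℚ indicator (inTour n u a b)
  per-edge : ∀ {e} → e ∈ edges n → term z e +ℚ term w e ≡ term x e +ℚ term y e
  per-edge {a , b} e∈ with ∈-edges⁻ e∈
  ... | 1≤a , a<b , b≤n with ex 1≤a a<b b≤n
  ...   | inj₁ (z≡x , w≡y) = cong₂ (λ p q → c a b *ℚ indicator p +ℚ c a b *ℚ indicator q) z≡x w≡y
  ...   | inj₂ (z≡y , w≡x) =
    trans (cong₂ (λ p q → c a b *ℚ indicator p +ℚ c a b *ℚ indicator q) z≡y w≡x)
          (ℚ.+-comm (term y (a , b)) (term x (a , b)))

exchange⇒¬adjacent : ∀ {x y z w : Enc n} → Exchange n x y z w →
                     charVec n z ≢ charVec n x → charVec n z ≢ charVec n y → ¬ Adjacent n x y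
exchange⇒¬adjacent {n} {x} {y} {z} {w} ex z≢x z≢y (_ , c , vx≡vy , maximal) =
  [ z≢x , z≢y ]′ (proj₂ (maximal z) vz≡vx)
  where
  vz≡vx : value n c z ≡ value n c x
  vz≡vx = p≤r∧q≤r∧p+q≡r+r⇒p≡r (proj₁ (maximal z)) (proj₁ (maximal w))
            (trans (value-exchange ex c) (cong (value n c x +ℚ_) (sym vx≡vy)))

penalty-own : ∀ p q → (if p ∨ q then 0ℚ else - 1ℚ) *ℚ indicator p ≡ 0ℚ
penalty-own true  true  = refl
penalty-own true  false = refl
penalty-own false true  = refl
penalty-own false false = refl

penalty-other : ∀ p q → (if p ∨ q then 0ℚ else - 1ℚ) *ℚ indicator q ≡ 0ℚ
penalty-other true  true  = refl
penalty-other true  false = refl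
penalty-other false true  = refl
penalty-other false false = refl

penalty≤0 : ∀ p r → (if p then 0ℚ else - 1ℚ) *ℚ indicator r ≤ℚ 0ℚ
penalty≤0 true  true  = ℚ.≤-refl
penalty≤0 true  false = ℚ.≤-refl
penalty≤0 false false = ℚ.≤-refl
penalty≤0 false true  = toWitness {a? = - 1ℚ ℚ.≤? 0ℚ} _

penalty≡0 : ∀ p → (if p then 0ℚ else - 1ℚ) *ℚ indicator true ≡ 0ℚ → T p
penalty≡0 true _ = _

EdgesCovered : ∀ n → (z x y : Enc n) → Set
EdgesCovered n z x y =
  ∀ {a b} → 1 ≤ a → a < b → b ≤ n → T (inTour n z a b) → T (inTour n x a b ∨ inTour n y a b)

-- The penalty functional is maximised, with value 0, exactly by the tours whose edges lie in x ∪ y.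
adjacent-if-rigid : ∀ {x y : Enc n} → charVec n x ≢ charVec n y →
                    (∀ z → EdgesCovered n z x y → charVec n z ≡ charVec n x ⊎ charVec n z ≡ charVec n y) →
                    Adjacent n x y
adjacent-if-rigid {n} {x} {y} x≢y rigid =
  x≢y , penalty , trans vx≡0 (sym vy≡0) ,
  λ z → subst (value n penalty z ≤ℚ_) (sym vx≡0) (sumℚ≤0 (edges n) (term≤0 z)) ,
        λ vz≡vx → rigid z (covered z (trans vz≡vx vx≡0))
  where
  penalty : ℕ → ℕ → ℚ
  penalty a b = if inTour n x a b ∨ inTour n y a b then 0ℚ else - 1ℚ
  term : Enc n → ℕ × ℕ → ℚ
  term u (a , b) = penalty a b *ℚ indicator (inTour n u a b)
  term≤0 : ∀ u e → term u e ≤ℚ 0ℚ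
  term≤0 u (a , b) = penalty≤0 (inTour n x a b ∨ inTour n y a b) (inTour n u a b)
  vx≡0 : value n penalty x ≡ 0ℚ
  vx≡0 = sumℚ≡0 (edges n) λ { {a , b} _ → penalty-own (inTour n x a b) (inTour n y a b) }
  vy≡0 : value n penalty y ≡ 0ℚ
  vy≡0 = sumℚ≡0 (edges n) λ { {a , b} _ → penalty-other (inTour n x a b) (inTour n y a b) }
  covered : ∀ z → value n penalty z ≡ 0ℚ → EdgesCovered n z x y
  covered z vz≡0 {a} {b} 1≤a a<b b≤n inZ = penalty≡0 _
    (subst (λ r → penalty a b *ℚ indicator r ≡ 0ℚ) (Equivalence.to T-≡ inZ)
           (sumℚ≡0⇒≡0 (edges n) (term≤0 z) vz≡0 (∈-edges⁺ 1≤a a<b b≤n)))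

spliceSide : ℕ → Side → Side → Side
spliceSide k X Y i with i ≤? k
... | yes _ = X i
... | no  _ = Y i

spliceSide-≤ : i ≤ k → spliceSide k X Y i ≡ X i
spliceSide-≤ {i} {k} i≤k with i ≤? k
... | yes _  = refl
... | no i≰k = contradiction i≤k i≰k

spliceSide-> : k < i → spliceSide k X Y i ≡ Y i
spliceSide-> {k} {i} k<i with i ≤? k
... | yes i≤k = contradiction i≤k (<⇒≱ k<i)
... | no _    = refl

spliced : ∀ n → ℕ → Enc n → Enc n → Enc n
spliced n k x y = fromSide n (spliceSide k (side n x) (λ i → side n y i xor diff (side n x) (side n y) k))

spliced-isSplice : {x y : Enc n} → switch (side n x) k ≡ true → switch (side n y) k ≡ true → 2 ≤ k → k < n →
                 Splice (side n x) (side n y) (side n (spliced n k x y)) n k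
spliced-isSplice {n} {k} {x} {y} sX sY 2≤k k<n =
  record { switchˣ = sX ; switchʸ = sY ; left = left ; right = right }
  where
  xˢ = side n x
  y′ = λ i → side n y i xor diff xˢ (side n y) k
  left : ∀ {i} → i ≤ k → side n (spliced n k x y) i ≡ side n x i
  left {0} _ = refl
  left {1} _ = refl
  left {2} _ = refl
  left {suc (suc (suc _))} i≤k =
    trans (side-fromSide {W = spliceSide k xˢ y′} (s≤s (s≤s (s≤s z≤n))) (≤-<-trans i≤k k<n))
          (spliceSide-≤ {X = xˢ} {y′} i≤k)
  right : ∀ {i} → k < i → i < n → side n (spliced n k x y) i ≡ side n y i xor diff (side n x) (side n y) k
  right k<i i<n = trans (side-fromSide {W = spliceSide k xˢ y′} (<-≤-trans (s≤s 2≤k) k<i) i<n)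
                        (spliceSide-> {X = xˢ} {y′} k<i)

isEdge⇔⇒inTour≡ : 3 ≤ n → {u v : Enc n} → 1 ≤ a → a < b → b ≤ n →
                  IsEdge (side n u) n a b ⇔ IsEdge (side n v) n a b → inTour n u a b ≡ inTour n v a b
isEdge⇔⇒inTour≡ 3≤n {u} {v} 1≤a a<b b≤n u⇔v =
  T⇔⇒≡ (⇔-trans (inTour⇔isEdge 3≤n u 1≤a a<b b≤n)
                (⇔-trans u⇔v (⇔-sym (inTour⇔isEdge 3≤n v 1≤a a<b b≤n))))

spliced-exchange : 3 ≤ n → {x y : Enc n} → switch (side n x) k ≡ true → switch (side n y) k ≡ true →
                   2 ≤ k → suc k < n → Exchange n x y (spliced n k x y) (spliced n k y x)
spliced-exchange {n} {k} 3≤n {x} {y} sX sY 2≤k k+1<n 1≤a a<b b≤n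
  with splice-edges (spliced-isSplice {x = x} {y} sX sY 2≤k (<-trans (n<1+n k) k+1<n))
                    (spliced-isSplice {x = y} {x} sY sX 2≤k (<-trans (n<1+n k) k+1<n)) k+1<n a<b b≤n
... | inj₁ (z⇔x , w⇔y) =
  inj₁ (isEdge⇔⇒inTour≡ 3≤n 1≤a a<b b≤n z⇔x , isEdge⇔⇒inTour≡ 3≤n 1≤a a<b b≤n w⇔y)
... | inj₂ (z⇔y , w⇔x) =
  inj₂ (isEdge⇔⇒inTour≡ 3≤n 1≤a a<b b≤n z⇔y , isEdge⇔⇒inTour≡ 3≤n 1≤a a<b b≤n w⇔x)

separatingSwitch⇒¬adjacent : 3 ≤ n → {x y : Enc n} → SeparatingSwitch (side n x) (side n y) n →
                             ¬ Adjacent n x y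
separatingSwitch⇒¬adjacent {n} 3≤n {x} {y}
  (k , k<n , sX , sY , (i , i<k , 2≤i , Di≢Dk) , (j , j<n , k+1<j , Dj≢Dk)) =
  exchange⇒¬adjacent (spliced-exchange 3≤n sX sY 2≤k k+1<n) z≢x (z≢y (diff xˢ yˢ k) refl)
  where
  xˢ = side n x
  yˢ = side n y
  z = spliced n k x y
  2≤k = ≤-trans 2≤i (<⇒≤ i<k)
  k+1<n = <-trans k+1<j j<n
  S = spliced-isSplice {x = x} {y} sX sY 2≤k k<n
  z≢x : charVec n z ≢ charVec n x
  z≢x eq = Dj≢Dk (xor-isolate (trans (sym (charVec-side 3≤n eq 2≤j j<n)) (Splice.right S k<j j<n)))
    where
    k<j = <-trans (n<1+n k) k+1<j
    2≤j = ≤-trans 2≤k (<⇒≤ k<j)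
  z≢y : ∀ d → diff xˢ yˢ k ≡ d → charVec n z ≢ charVec n y
  z≢y false Dk eq =
    Di≢Dk (trans (≡⇒xor≡false (trans (sym (Splice.left S (<⇒≤ i<k))) (charVec-side 3≤n eq 2≤i i<n))) (sym Dk))
    where i<n = <-trans i<k k<n
  z≢y true Dk eq = contradiction (trans (sym (xor-same (yˢ (suc k)))) (trans (xor-isolate Yk+1≡Yk+1+Dk) Dk)) λ ()
    where
    Yk+1≡Yk+1+Dk : yˢ (suc k) ≡ yˢ (suc k) xor diff xˢ yˢ k
    Yk+1≡Yk+1+Dk = trans (sym (charVec-side 3≤n eq (≤-trans 2≤k (n≤1+n k)) k+1<n))
                         (Splice.right S (n<1+n k) k+1<n)

¬separatingSwitch⇒adjacent : 3 ≤ n → {x y : Enc n} → x ≢ y → ¬ SeparatingSwitch (side n x) (side n y) n →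
                             Adjacent n x y
¬separatingSwitch⇒adjacent {n} 3≤n {x} {y} x≢y ¬sep = adjacent-if-rigid (x≢y ∘ charVec-injective 3≤n) rigid
  where
  rigid : ∀ z → EdgesCovered n z x y → charVec n z ≡ charVec n x ⊎ charVec n z ≡ charVec n y
  rigid z edges⊆ with ≡-dec _≟ᵇ_ z x | ≡-dec _≟ᵇ_ z y
  ... | yes refl | _        = inj₁ refl
  ... | no _     | yes refl = inj₂ refl
  ... | no z≢x   | no z≢y   = ⊥-elim (¬sep (covered⇒separatingSwitch (refl , refl) (refl , refl) (refl , refl)
                                             covered (differ-somewhere z≢x) (differ-somewhere z≢y)))
    where
    covered : Covered (side n x) (side n y) (side n z) n
    covered 1≤a a<b b≤n e =
      Data.Sum.map (Equivalence.to (edge⇔ x)) (Equivalence.to (edge⇔ y))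
                   (Equivalence.to T-∨ (edges⊆ 1≤a a<b b≤n (Equivalence.from (edge⇔ z) e)))
      where edge⇔ = λ u → inTour⇔isEdge 3≤n u 1≤a a<b b≤n

theorem3 : (n : ℕ) → 3 ≤ n → (x y : Enc n) → x ≢ y →
    ((¬ Adjacent n x y) ⇔ (Cond1 n x y ⊎ Cond2 n x y))
theorem3 n 3≤n x y x≢y = mk⇔ nonAdjacent⇒cond cond⇒nonAdjacent
  where
  cond⇒nonAdjacent : Cond1 n x y ⊎ Cond2 n x y → ¬ Adjacent n x y
  cond⇒nonAdjacent c = separatingSwitch⇒¬adjacent 3≤n
    (cond⇒separatingSwitch refl (cond-cong (sym ∘ side≡xc x) (sym ∘ side≡xc y) c))
  nonAdjacent⇒cond : ¬ Adjacent n x y → Cond1 n x y ⊎ Cond2 n x y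
  nonAdjacent⇒cond ¬adj = cond-cong (side≡xc x) (side≡xc y) (separatingSwitch⇒cond refl
    (decidable-stable (separatingSwitch? (side n x) (side n y) n)
                      (¬adj ∘ ¬separatingSwitch⇒adjacent 3≤n x≢y)))
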